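{- For any finite graph $G$ the following are equivalent: (1) $\omega(H)=\psi(H)$ for every induced subgraph $H$ of $G$; (2) $b(H)=\psi(H)$ for every induced subgraph $H$ of $G$; (3) $B(H)=\psi(H)$ for every induced subgraph $H$ of $G$; (4) $G$ has no induced subgraph isomorphic to any of $C_4$, $P_4$, $P_3\cup K_2$, $3K_2$.
   Context: All graphs are finite and simple. A $k$-coloring of $G$ is a surjective map $\varsigma\colon V(G)\to\{1,\dots,k\}$; it is proper if adjacent vertices get different colors; it is complete if for every pair of distinct colors $i,j$ there is an edge $xy$ with $\varsigma(x)=i$, $\varsigma(y)=j$; it is dominating if every color class contains a vertex having a neighbor in every other color class. $\omega(G)$ is the clique number. The pseudoachromatic number $\psi(G)$ is the largest $k$ for which $G$ has a complete $k$-coloring. The pseudo-$b$-chromatic number $B(G)$ is the largest $k$ for which $G$ has a dominating $k$-coloring, and the $b$-chromatic number $b(G)$ is the largest $k$ for which $G$ has a proper dominating $k$-coloring. $C_n$ is the cycle and $P_n$ the path on $n$ vertices, $K_2$ is a single edge, $P_3\cup K_2$ is the disjoint union of $P_3$ and $K_2$, and $3K_2$ is the disjoint union of three copies of $K_2$. -}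

module Defs where

open import Data.Nat using (ℕ; _≤_; _≡ᵇ_)
open import Data.Fin using (Fin; toℕ)
open import Data.Bool using (Bool; true; false; _∧_; _∨_)
open import Data.List using (List; []; _∷_)
open import Data.Bool.ListAction using (any)
open import Data.Product using (Σ; ∃; ∃-syntax; _×_; _,_)
open import Data.Sum using (_⊎_)
open import Relation.Binary.PropositionalEquality using (_≡_; _≢_)
open import Function.Definitions using (Injective)
open import Function.Bundles using (_⇔_)

record Graph : Set where
  constructor mkGraph
  field
    n   : ℕ
    adj : Fin n → Fin n → Bool
open Graph public

Edge : (G : Graph) → Fin (n G) → Fin (n G) → Set
Edge G x y = adj G x y ≡ true

IsSimple : Graph → Set
IsSimple G = (∀ x y → adj G x y ≡ adj G y x) × (∀ x → adj G x x ≡ false)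

induced : (G : Graph) {m : ℕ} → (Fin m → Fin (n G)) → Graph
induced G {m} f = mkGraph m (λ x y → adj G (f x) (f y))

HasInduced : Graph → Graph → Set
HasInduced F G = Σ (Fin (n F) → Fin (n G)) λ f →
  Injective _≡_ _≡_ f × (∀ x y → adj F x y ≡ adj G (f x) (f y))

IsMax : (ℕ → Set) → ℕ → Set
IsMax P k = P k × (∀ j → P j → j ≤ k)

HasClique : Graph → ℕ → Set
HasClique G k = Σ (Fin k → Fin (n G)) λ f →
  Injective _≡_ _≡_ f × (∀ i j → i ≢ j → Edge G (f i) (f j))

-- colorings: surjective maps onto the k colours Fin k
Surj : {a b : ℕ} → (Fin a → Fin b) → Set
Surj {a} {b} c = ∀ (i : Fin b) → ∃[ x ] c x ≡ i

Proper : (G : Graph) {k : ℕ} → (Fin (n G) → Fin k) → Set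
Proper G c = ∀ x y → Edge G x y → c x ≢ c y

Complete : (G : Graph) {k : ℕ} → (Fin (n G) → Fin k) → Set
Complete G {k} c = ∀ (i j : Fin k) → i ≢ j →
  ∃[ x ] ∃[ y ] (Edge G x y × c x ≡ i × c y ≡ j)

Dominating : (G : Graph) {k : ℕ} → (Fin (n G) → Fin k) → Set
Dominating G {k} c = ∀ (i : Fin k) → ∃[ x ] (c x ≡ i ×
  (∀ (j : Fin k) → j ≢ i → ∃[ y ] (Edge G x y × c y ≡ j)))

HasCompleteColoring HasDominatingColoring HasBColoring : Graph → ℕ → Set
HasCompleteColoring G k = Σ (Fin (n G) → Fin k) λ c → Surj c × Complete G c
HasDominatingColoring G k = Σ (Fin (n G) → Fin k) λ c → Surj c × Dominating G c
HasBColoring G k = Σ (Fin (n G) → Fin k) λ c → Surj c × Proper G c × Dominating G c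

-- ω, ψ, B, b as "k is the value of ..." relations
IsOmega IsPsi IsPseudoB IsB : Graph → ℕ → Set
IsOmega G = IsMax (HasClique G)
IsPsi G = IsMax (HasCompleteColoring G)
IsPseudoB G = IsMax (HasDominatingColoring G)
IsB G = IsMax (HasBColoring G)

SameValue : (Graph → ℕ → Set) → (Graph → ℕ → Set) → Graph → Set
SameValue I J H = ∃[ k ] (I H k × J H k)

ForAllInduced : (Graph → Set) → Graph → Set
ForAllInduced P G = ∀ (m : ℕ) (f : Fin m → Fin (n G)) → Injective _≡_ _≡_ f → P (induced G f)

fromEdges : (k : ℕ) → List (ℕ × ℕ) → Graph
fromEdges k es = mkGraph k (λ x y → any (λ { (a , b) →
  ((toℕ x ≡ᵇ a) ∧ (toℕ y ≡ᵇ b)) ∨ ((toℕ x ≡ᵇ b) ∧ (toℕ y ≡ᵇ a)) }) es)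

C4 P4 P3∪K2 3K2 : Graph
C4 = fromEdges 4 ((0 , 1) ∷ (1 , 2) ∷ (2 , 3) ∷ (3 , 0) ∷ [])
P4 = fromEdges 4 ((0 , 1) ∷ (1 , 2) ∷ (2 , 3) ∷ [])
P3∪K2 = fromEdges 5 ((0 , 1) ∷ (1 , 2) ∷ (3 , 4) ∷ [])
3K2 = fromEdges 6 ((0 , 1) ∷ (2 , 3) ∷ (4 , 5) ∷ [])

Forbidden : Graph → Set
Forbidden G = HasInduced C4 G ⊎ HasInduced P4 G ⊎ HasInduced P3∪K2 G ⊎ HasInduced 3K2 G

module Submission where

-- We prove the cycle (1) ⇒ (2) ⇒ (3) ⇒ (4) ⇒ (1).
--   (1) ⇒ (2): every simple graph has a b-colouring (merge colour classes without dominant vertex);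
--     being proper it has ≥ ω colours, being complete ≤ ψ colours.
--   (2) ⇒ (3): a b-colouring is dominating, and dominating colourings are complete.
--   (3) ⇒ (4): each forbidden graph F has a complete 3-colouring but no dominating colouring with
--     ≥ 3 colours (the dominant vertices would need degree ≥ 2, and in C4 two of them are twins).
--   (4) ⇒ (1): by induction on the order, a forbidden-free graph has a clique as large as any complete
--     colouring: isolated and universal vertices are deleted, and otherwise the closed neighbourhood
--     of a vertex of maximum degree is a clique carrying (up to size) every complete colouring.

open import Defs
open import Data.Bool as Bool using (Bool; true; false; _∨_; if_then_else_)
open import Data.Bool.Properties using (¬-not; not-¬)
open import Data.Empty using (⊥; ⊥-elim)
open import Data.Fin as Fin using (Fin; zero; suc; _≟_; punchIn; punchOut; #_)
open import Data.Fin.Properties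
  using (injective⇒≤; suc-injective; <-cmp; all?; any?; ¬∀⟶∃¬; punchIn-injective; punchInᵢ≢i;
         punchIn-punchOut; punchOut-injective; punchOut-cong; punchOut-punchIn)
open import Data.List using (List; []; _∷_; _++_; filter; allFin)
import Data.List as List
open import Data.List.Membership.Propositional using (_∈_)
open import Data.List.Membership.Propositional.Properties using (∈-++⁺ˡ; ∈-++⁺ʳ; ∈-map⁺; ∈-filter⁺; ∈-allFin)
open import Data.List.Relation.Unary.All as All using (All; _∷_; [])
open import Data.Nat as ℕ using (ℕ; zero; suc; _+_; _≤_; _<_; _≤?_; z≤n; s≤s; s<s⁻¹)
open import Data.Nat.Properties using (≤-refl; ≤-trans; ≤-antisym; <⇒≤; ≰⇒>; <⇒≱)
open import Data.Product as Product using (Σ; ∃; ∃-syntax; _×_; _,_; proj₁; proj₂)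
open import Data.Sum as Sum using (_⊎_; inj₁; inj₂)
open import Data.Vec using (Vec; _∷_; []; lookup)
open import Function using (_∘_; const)
open import Function.Bundles using (_⇔_; mk⇔)
open import Function.Definitions using (Injective)
open import Relation.Binary using (tri<; tri≈; tri>)
open import Relation.Binary.PropositionalEquality
open import Relation.Nullary using (Dec; yes; no; ¬_; does)
open import Relation.Nullary.Decidable using (_×-dec_; _⊎-dec_; _→-dec_; ¬?; from-yes; dec-true)

count : ∀ {n} → (Fin n → Bool) → ℕ
count {zero}  p = 0
count {suc n} p = (if p zero then 1 else 0) + count (p ∘ suc)

record Enumeration {n} (p : Fin n → Bool) (m : ℕ) : Set where
  field
    element   : Fin m → Fin n
    injective : Injective _≡_ _≡_ element
    sound     : ∀ i → p (element i) ≡ true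
    position  : ∀ x → p x ≡ true → ∃[ i ] element i ≡ x

enumerate : ∀ {n} (p : Fin n → Bool) → Enumeration p (count p)
enumerate {zero}  p = record { element = λ () ; injective = λ { {()} } ; sound = λ () ; position = λ () }
enumerate {suc n} p = extend (p zero) refl (enumerate (p ∘ suc))
  where
  extend : ∀ {m} b → p zero ≡ b → Enumeration (p ∘ suc) m →
           Enumeration p ((if b then 1 else 0) + m)
  extend true p0 E = record { element = element′ ; injective = injective′ ; sound = sound′ ; position = position′ }
    where
    open Enumeration E
    element′ : Fin (suc _) → Fin (suc n)
    element′ zero    = zero
    element′ (suc i) = suc (element i)
    injective′ : Injective _≡_ _≡_ element′
    injective′ {zero}  {zero}  _  = refl
    injective′ {zero}  {suc _} ()
    injective′ {suc _} {zero}  ()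
    injective′ {suc i} {suc j} e = cong suc (injective (suc-injective e))
    sound′ : ∀ i → p (element′ i) ≡ true
    sound′ zero    = p0
    sound′ (suc i) = sound i
    position′ : ∀ x → p x ≡ true → ∃[ i ] element′ i ≡ x
    position′ zero    _  = zero , refl
    position′ (suc x) px with position x px
    ... | i , eᵢ≡x = suc i , cong suc eᵢ≡x
  extend false p0 E = record { element = suc ∘ element ; injective = injective ∘ suc-injective
                             ; sound = sound ; position = position′ }
    where
    open Enumeration E
    position′ : ∀ x → p x ≡ true → ∃[ i ] suc (element i) ≡ x
    position′ zero    px with () ← trans (sym px) p0
    position′ (suc x) px with position x px
    ... | i , eᵢ≡x = i , cong suc eᵢ≡x

count-≥ : ∀ {n m} {p : Fin n → Bool} (g : Fin m → Fin n) → Injective _≡_ _≡_ g →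
          (∀ i → p (g i) ≡ true) → m ≤ count p
count-≥ {p = p} g g-inj pg = injective⇒≤ {f = λ i → proj₁ (located i)} λ {i} {j} e →
  g-inj (trans (sym (proj₂ (located i))) (trans (cong element e) (proj₂ (located j))))
  where
  open Enumeration (enumerate p)
  located : ∀ i → ∃[ k ] element k ≡ g i
  located i = position (g i) (pg i)

count-< : ∀ {n} {p q : Fin n → Bool} → (∀ x → p x ≡ true → q x ≡ true) →
          ∀ w → p w ≡ false → q w ≡ true → count p < count q
count-< {n} {p} {q} p⊆q w pw qw = count-≥ g g-inj g∈q
  where
  open Enumeration (enumerate p)
  g : Fin (suc (count p)) → Fin n
  g zero    = w
  g (suc i) = element i
  g∈q : ∀ i → q (g i) ≡ true
  g∈q zero    = qw
  g∈q (suc i) = p⊆q _ (sound i)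
  not-w : ∀ i → element i ≢ w
  not-w i eᵢ≡w with () ← trans (sym (sound i)) (trans (cong p eᵢ≡w) pw)
  g-inj : Injective _≡_ _≡_ g
  g-inj {zero}  {zero}  _ = refl
  g-inj {zero}  {suc j} e = ⊥-elim (not-w j (sym e))
  g-inj {suc i} {zero}  e = ⊥-elim (not-w i e)
  g-inj {suc i} {suc j} e = cong suc (injective e)

colours≤count : ∀ {n k} (p : Fin n → Bool) (c : Fin n → Fin k) →
                (∀ i → ∃[ x ] (p x ≡ true × c x ≡ i)) → k ≤ count p
colours≤count p c occurs = count-≥ (proj₁ ∘ occurs) g-inj (proj₁ ∘ proj₂ ∘ occurs)
  where
  g-inj : Injective _≡_ _≡_ (proj₁ ∘ occurs)
  g-inj {i} {j} e = trans (sym (proj₂ (proj₂ (occurs i)))) (trans (cong c e) (proj₂ (proj₂ (occurs j))))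

-- Decision procedures: on a fixed small graph these properties are settled by evaluation.

edge? : (G : Graph) (x y : Fin (n G)) → Dec (Edge G x y)
edge? G x y = adj G x y Bool.≟ true

simple? : (G : Graph) → Dec (IsSimple G)
simple? G = all? (λ x → all? λ y → adj G x y Bool.≟ adj G y x) ×-dec all? (λ x → adj G x x Bool.≟ false)

surjective? : ∀ {a b} (c : Fin a → Fin b) → Dec (Surj c)
surjective? c = all? λ i → any? λ x → c x ≟ i

complete? : (G : Graph) {k : ℕ} (c : Fin (n G) → Fin k) → Dec (Complete G c)
complete? G c = all? λ i → all? λ j → ¬? (i ≟ j) →-dec
  any? λ x → any? λ y → edge? G x y ×-dec (c x ≟ i ×-dec c y ≟ j)

Twins : (G : Graph) → Fin (n G) → Fin (n G) → Set
Twins G x y = ∀ z → adj G x z ≡ adj G y z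

twins? : (G : Graph) (x y : Fin (n G)) → Dec (Twins G x y)
twins? G x y = all? λ z → adj G x z Bool.≟ adj G y z

adjacent⇒distinct : ∀ G → IsSimple G → ∀ {x y} → Edge G x y → x ≢ y
adjacent⇒distinct G (_ , loopless) {x} xy refl with () ← trans (sym (loopless x)) xy

-- A dominating colouring is complete: the dominating vertex of class i has a neighbour in class j.
dominating⇒complete : ∀ G {k} (c : Fin (n G) → Fin k) → Dominating G c → Complete G c
dominating⇒complete G c dom i j i≢j with dom i
... | x , cx≡i , sees with sees j (i≢j ∘ sym)
... | y , xy , cy≡j = x , y , xy , cx≡i , cy≡j

surjective⇒≤ : ∀ {a b} (c : Fin a → Fin b) → Surj c → b ≤ a
surjective⇒≤ c onto = injective⇒≤ {f = proj₁ ∘ onto} λ {i} {j} e →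
  trans (sym (proj₂ (onto i))) (trans (cong c e) (proj₂ (onto j)))

clique≤colours : ∀ G {j k} (c : Fin (n G) → Fin k) → Proper G c → HasClique G j → j ≤ k
clique≤colours G c proper (g , g-inj , edges) = injective⇒≤ {f = c ∘ g} c∘g-inj
  where
  c∘g-inj : Injective _≡_ _≡_ (c ∘ g)
  c∘g-inj {x} {y} e with x ≟ y
  ... | yes x≡y = x≡y
  ... | no  x≢y = ⊥-elim (proper (g x) (g y) (edges x y x≢y) e)

-- Colouring a nonempty clique by position (everything else gets colour 0) is complete.
clique⇒complete : ∀ G {j} → HasClique G (suc j) → HasCompleteColoring G (suc j)
clique⇒complete G {j} (g , g-inj , edges) = c , (λ i → g i , c-g i) , λ i i′ i≢i′ →
  g i , g i′ , edges i i′ i≢i′ , c-g i , c-g i′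
  where
  c : Fin (n G) → Fin (suc j)
  c x with any? (λ i → g i ≟ x)
  ... | yes (i , _) = i
  ... | no _        = zero
  c-g : ∀ i → c (g i) ≡ i
  c-g i with any? (λ i′ → g i′ ≟ g i)
  ... | yes (i′ , gi′≡gi) = g-inj gi′≡gi
  ... | no  none          = ⊥-elim (none (i , refl))

module _ {m k} {a a′ : Fin m → Fin m → Bool} (more : ∀ x y → a x y ≡ true → a′ x y ≡ true)
         (c : Fin m → Fin k) where

  complete-mono : Complete (mkGraph m a) c → Complete (mkGraph m a′) c
  complete-mono cmp i j i≢j with cmp i j i≢j
  ... | x , y , xy , cx , cy = x , y , more x y xy , cx , cy

  dominating-mono : Dominating (mkGraph m a) c → Dominating (mkGraph m a′) c
  dominating-mono dom i with dom i
  ... | x , cx≡i , sees = x , cx≡i , λ j j≢i → let y , xy , cy≡j = sees j j≢i in y , more x y xy , cy≡j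

induced-trans : ∀ F G {m} (f : Fin m → Fin (n G)) → Injective _≡_ _≡_ f →
                HasInduced F (induced G f) → HasInduced F G
induced-trans F G f f-inj (g , g-inj , same) = f ∘ g , g-inj ∘ f-inj , same

forbidden-free-induced : ∀ G {m} (f : Fin m → Fin (n G)) → Injective _≡_ _≡_ f →
                         ¬ Forbidden G → ¬ Forbidden (induced G f)
forbidden-free-induced G f f-inj free =
  free ∘ Sum.map (lift C4) (Sum.map (lift P4) (Sum.map (lift P3∪K2) (lift 3K2)))
  where
  lift : ∀ F → HasInduced F (induced G f) → HasInduced F G
  lift F = induced-trans F G f f-inj

simple-induced : ∀ G {m} (f : Fin m → Fin (n G)) → IsSimple G → IsSimple (induced G f)
simple-induced G f (symmetric , loopless) = (λ x y → symmetric (f x) (f y)) , loopless ∘ f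

-- All pairs (x , y) with x < y, in lexicographic order.
pairs : ∀ k → List (Fin k × Fin k)
pairs zero    = []
pairs (suc k) = List.map (λ y → zero , suc y) (allFin k) ++ List.map (Product.map suc suc) (pairs k)

pairs-complete : ∀ {k} {x y : Fin k} → x Fin.< y → (x , y) ∈ pairs k
pairs-complete {x = zero}  {zero}  ()
pairs-complete {x = zero}  {suc y} _   = ∈-++⁺ˡ (∈-map⁺ (λ y → zero , suc y) (∈-allFin y))
pairs-complete {x = suc x} {suc y} x<y =
  ∈-++⁺ʳ _ (∈-map⁺ (Product.map suc suc) (pairs-complete (s<s⁻¹ x<y)))

TwinPair : (F : Graph) → Fin (n F) × Fin (n F) → Set
TwinPair F (x , y) = Twins F x y

twinPair? : (F : Graph) (p : Fin (n F) × Fin (n F)) → Dec (TwinPair F p)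
twinPair? F (x , y) = twins? F x y

-- The pairs x < y of twins of F; only these need not be separated by a neighbour in a copy of F.
twinPairs : (F : Graph) → List (Fin (n F) × Fin (n F))
twinPairs F = filter (twinPair? F) (pairs (n F))

Agrees : (F G : Graph) → (Fin (n F) → Fin (n G)) → Fin (n F) × Fin (n F) → Set
Agrees F G f (x , y) = adj G (f x) (f y) ≡ adj F x y

Apart : ∀ {k m} → (Fin k → Fin m) → Fin k × Fin k → Set
Apart f (x , y) = f x ≢ f y

-- An induced copy of the simple graph F in the simple graph G, given by a list of vertices:
-- adjacency needs checking only on pairs x < y, and distinctness only on twins of F, since
-- vertices of F that are not twins are told apart by a neighbour.
embed : ∀ {G F} → IsSimple G → IsSimple F → (vs : Vec (Fin (n G)) (n F)) →
        All (Agrees F G (lookup vs)) (pairs (n F)) → All (Apart (lookup vs)) (twinPairs F) →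
        HasInduced F G
embed {G} {F} (symG , looplessG) (symF , looplessF) vs agrees apart = f , f-inj , λ x y → sym (agree x y)
  where
  f : Fin (n F) → Fin (n G)
  f = lookup vs
  agree : ∀ x y → adj G (f x) (f y) ≡ adj F x y
  agree x y with <-cmp x y
  ... | tri< x<y _ _  = All.lookup agrees (pairs-complete x<y)
  ... | tri≈ _ refl _ = trans (looplessG (f x)) (sym (looplessF x))
  ... | tri> _ _ y<x  = trans (symG (f x) (f y)) (trans (All.lookup agrees (pairs-complete y<x)) (symF y x))
  separated : ∀ {x y} → x Fin.< y → f x ≢ f y
  separated {x} {y} x<y fx≡fy = All.lookup apart (∈-filter⁺ (twinPair? F) (pairs-complete x<y) twins) fx≡fy
    where
    twins : Twins F x y
    twins z = trans (sym (agree x z)) (trans (cong (λ u → adj G u (f z)) fx≡fy) (agree y z))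
  f-inj : Injective _≡_ _≡_ f
  f-inj {x} {y} fx≡fy with <-cmp x y
  ... | tri< x<y _ _ = ⊥-elim (separated x<y fx≡fy)
  ... | tri≈ _ x≡y _ = x≡y
  ... | tri> _ _ y<x = ⊥-elim (separated y<x (sym fx≡fy))

degree : (G : Graph) → Fin (n G) → ℕ
degree G x = count (adj G x)

#degree≥ : Graph → ℕ → ℕ
#degree≥ G d = count (λ x → does (d ≤? degree G x))

Sees : (G : Graph) {k : ℕ} → (Fin (n G) → Fin k) → Fin (n G) → Fin k → Set
Sees G c x j = ∃[ y ] (Edge G x y × c y ≡ j)

sees? : (G : Graph) {k : ℕ} (c : Fin (n G) → Fin k) (x : Fin (n G)) (j : Fin k) → Dec (Sees G c x j)
sees? G c x j = any? λ y → edge? G x y ×-dec c y ≟ j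

Dominant : (G : Graph) {k : ℕ} → (Fin (n G) → Fin k) → Fin k → Fin (n G) → Set
Dominant G c i x = c x ≡ i × (∀ j → j ≢ i → Sees G c x j)

dominant? : (G : Graph) {k : ℕ} (c : Fin (n G) → Fin k) (i : Fin k) (x : Fin (n G)) → Dec (Dominant G c i x)
dominant? G c i x = c x ≟ i ×-dec all? λ j → ¬? (j ≟ i) →-dec sees? G c x j

dominant-distinct : ∀ {G k} {c : Fin (n G) → Fin k} {i j x y} →
                    Dominant G c i x → Dominant G c j y → i ≢ j → x ≢ y
dominant-distinct (cx≡i , _) (cy≡j , _) i≢j refl = i≢j (trans (sym cx≡i) cy≡j)

dominant-degree : ∀ G {k} (c : Fin (n G) → Fin (suc k)) {i x} → Dominant G c i x → k ≤ degree G x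
dominant-degree G c {i} {x} (_ , sees) = count-≥ (proj₁ ∘ seen) g-inj (proj₁ ∘ proj₂ ∘ seen)
  where
  seen : ∀ j → Sees G c x (punchIn i j)
  seen j = sees (punchIn i j) (punchInᵢ≢i i j)
  g-inj : Injective _≡_ _≡_ (proj₁ ∘ seen)
  g-inj {j} {j′} e = punchIn-injective i j j′
    (trans (sym (proj₂ (proj₂ (seen j)))) (trans (cong c e) (proj₂ (proj₂ (seen j′)))))

dominating⇒high-degree : ∀ G {d k} (c : Fin (n G) → Fin k) → suc d ≤ k → Dominating G c → k ≤ #degree≥ G d
dominating⇒high-degree G {d} {suc k} c (s≤s d≤k) dom = count-≥ (proj₁ ∘ dom) g-inj high
  where
  g-inj : Injective _≡_ _≡_ (proj₁ ∘ dom)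
  g-inj {i} {j} e = trans (sym (proj₁ (proj₂ (dom i)))) (trans (cong c e) (proj₁ (proj₂ (dom j))))
  high : ∀ i → does (d ≤? degree G (proj₁ (dom i))) ≡ true
  high i = dec-true (d ≤? _) (≤-trans d≤k (dominant-degree G c (proj₂ (dom i))))

twin-dominant-degree : ∀ G {k} (c : Fin (n G) → Fin k) {i j p q} →
                       Dominant G c i p → Dominant G c j q → i ≢ j → Twins G p q → k ≤ degree G p
twin-dominant-degree G c {i} {j} {p} {q} (_ , sees-p) (_ , sees-q) i≢j twins = colours≤count (adj G p) c seen
  where
  seen : ∀ l → Sees G c p l
  seen l with l ≟ i
  ... | no  l≢i = sees-p l l≢i
  ... | yes refl with sees-q l i≢j
  ...   | y , qy , cy≡l = y , trans (twins y) qy , cy≡l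

C4-simple : IsSimple C4
C4-simple = from-yes (simple? C4)

P4-simple : IsSimple P4
P4-simple = from-yes (simple? P4)

P3∪K2-simple : IsSimple P3∪K2
P3∪K2-simple = from-yes (simple? P3∪K2)

3K2-simple : IsSimple 3K2
3K2-simple = from-yes (simple? 3K2)

C4-colouring : HasCompleteColoring C4 3
C4-colouring = c , from-yes (surjective? c) , from-yes (complete? C4 c)
  where
  c : Fin 4 → Fin 3
  c = lookup (# 0 ∷ # 1 ∷ # 2 ∷ # 2 ∷ [])

P4-colouring : HasCompleteColoring P4 3
P4-colouring = c , from-yes (surjective? c) , from-yes (complete? P4 c)
  where
  c : Fin 4 → Fin 3
  c = lookup (# 0 ∷ # 1 ∷ # 2 ∷ # 0 ∷ [])

P3∪K2-colouring : HasCompleteColoring P3∪K2 3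
P3∪K2-colouring = c , from-yes (surjective? c) , from-yes (complete? P3∪K2 c)
  where
  c : Fin 5 → Fin 3
  c = lookup (# 0 ∷ # 1 ∷ # 2 ∷ # 0 ∷ # 2 ∷ [])

3K2-colouring : HasCompleteColoring 3K2 3
3K2-colouring = c , from-yes (surjective? c) , from-yes (complete? 3K2 c)
  where
  c : Fin 6 → Fin 3
  c = lookup (# 0 ∷ # 1 ∷ # 1 ∷ # 2 ∷ # 2 ∷ # 0 ∷ [])

few-high-degree⇒no-dominating : ∀ F → #degree≥ F 2 ≤ 2 → ∀ {k} → 3 ≤ k → ¬ HasDominatingColoring F k
few-high-degree⇒no-dominating F few 3≤k (c , _ , dom) =
  <⇒≱ (s≤s few) (≤-trans 3≤k (dominating⇒high-degree F c 3≤k dom))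

C4-twins-among-three : ∀ x y z → x ≢ y → x ≢ z → y ≢ z → Twins C4 x y ⊎ Twins C4 x z ⊎ Twins C4 y z
C4-twins-among-three = from-yes (all? λ x → all? λ y → all? λ z →
  ¬? (x ≟ y) →-dec (¬? (x ≟ z) →-dec (¬? (y ≟ z) →-dec
  (twins? C4 x y ⊎-dec (twins? C4 x z ⊎-dec twins? C4 y z)))))

C4-degree : ∀ x → degree C4 x ≡ 2
C4-degree = from-yes (all? λ x → degree C4 x ℕ.≟ 2)

-- In C4, twins cannot be dominant vertices of different classes of a colouring with ≥ 3 colours:
-- one of them would see all colours with only two neighbours.
C4-no-dominant-twins : ∀ {k} (c : Fin 4 → Fin (3 + k)) {i j p q} →
                       Dominant C4 c i p → Dominant C4 c j q → i ≢ j → ¬ Twins C4 p q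
C4-no-dominant-twins {k} c {p = p} dp dq i≢j twins =
  <⇒≱ (s≤s (s≤s (s≤s z≤n))) (subst (3 + k ≤_) (C4-degree p) (twin-dominant-degree C4 c dp dq i≢j twins))

-- Hence C4 has no dominating colouring with ≥ 3 colours, as two of the dominant vertices of
-- classes 0, 1, 2 are twins.
C4-no-dominating : ∀ {k} → 3 ≤ k → ¬ HasDominatingColoring C4 k
C4-no-dominating (s≤s (s≤s (s≤s _))) (c , _ , dom)
  with dom (# 0) | dom (# 1) | dom (# 2)
... | x , dx | y , dy | z , dz
  with C4-twins-among-three x y z (dominant-distinct dx dy (λ ())) (dominant-distinct dx dz (λ ()))
                                  (dominant-distinct dy dz (λ ()))
... | inj₁ twins        = C4-no-dominant-twins c dx dy (λ ()) twins
... | inj₂ (inj₁ twins) = C4-no-dominant-twins c dx dz (λ ()) twins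
... | inj₂ (inj₂ twins) = C4-no-dominant-twins c dy dz (λ ()) twins

-- Existence of b-colourings

module _ (G : Graph) (simple : IsSimple G) where

  -- A proper colouring in which class i has no dominant vertex loses class i: each vertex of
  -- class i misses some other colour in its neighbourhood and can be moved there.
  merge-class : ∀ {k} (c : Fin (n G) → Fin (suc k)) → Surj c → Proper G c →
                (i : Fin (suc k)) → (∀ x → ¬ Dominant G c i x) →
                Σ (Fin (n G) → Fin k) λ c′ → Surj c′ × Proper G c′
  merge-class {k} c onto proper i none = c′ , onto′ , proper′
    where
    missing : ∀ x → c x ≡ i → ∃[ j ] (i ≢ j × ¬ Sees G c x j)
    missing x cx≡i with ¬∀⟶∃¬ _ _ (λ j → ¬? (j ≟ i) →-dec sees? G c x j) (λ all → none x (cx≡i , all))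
    ... | j , not-seen with j ≟ i
    ...   | yes j≡i = ⊥-elim (not-seen (λ j≢i → ⊥-elim (j≢i j≡i)))
    ...   | no  j≢i = j , j≢i ∘ sym , λ seen → not-seen (λ _ → seen)
    move : ∀ x → Dec (c x ≡ i) → Fin (suc k)
    move x (yes cx≡i) = proj₁ (missing x cx≡i)
    move x (no  _)    = c x
    move≢i : ∀ x d → i ≢ move x d
    move≢i x (yes cx≡i) = proj₁ (proj₂ (missing x cx≡i))
    move≢i x (no  cx≢i) = cx≢i ∘ sym
    c′ : Fin (n G) → Fin k
    c′ x = punchOut (move≢i x (c x ≟ i))
    move-proper : ∀ x y dx dy → Edge G x y → move x dx ≢ move y dy
    move-proper x y (yes cx≡i) (yes cy≡i) xy _ = proper x y xy (trans cx≡i (sym cy≡i))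
    move-proper x y (yes cx≡i) (no  _)    xy e = proj₂ (proj₂ (missing x cx≡i)) (y , xy , sym e)
    move-proper x y (no  _)    (yes cy≡i) xy e =
      proj₂ (proj₂ (missing y cy≡i)) (x , trans (proj₁ simple y x) xy , e)
    move-proper x y (no  _)    (no  _)    xy e = proper x y xy e
    proper′ : Proper G c′
    proper′ x y xy e =
      move-proper x y (c x ≟ i) (c y ≟ i) xy (punchOut-injective (move≢i x (c x ≟ i)) (move≢i y (c y ≟ i)) e)
    -- vertices outside class i keep their colour, renumbered by punchOut
    kept : ∀ {x t} (d : Dec (c x ≡ i)) → c x ≡ punchIn i t → punchOut (move≢i x d) ≡ t
    kept {t = t} (yes cx≡i) cx≡t′ = ⊥-elim (punchInᵢ≢i i t (trans (sym cx≡t′) cx≡i))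
    kept         (no  _)    cx≡t′ = trans (punchOut-cong i cx≡t′) (punchOut-punchIn i)
    onto′ : Surj c′
    onto′ t = let x , cx≡t′ = onto (punchIn i t) in x , kept (c x ≟ i) cx≡t′

  -- Merging classes until every class has a dominant vertex yields a b-colouring.
  b-colouring-from : ∀ k (c : Fin (n G) → Fin k) → Surj c → Proper G c → ∃ (HasBColoring G)
  b-colouring-from k c onto proper with all? (λ i → any? (dominant? G c i))
  ... | yes dom = k , c , onto , proper , dom
  b-colouring-from zero    c onto proper | no not-dom = ⊥-elim (not-dom λ ())
  b-colouring-from (suc k) c onto proper | no not-dom
    with ¬∀⟶∃¬ _ _ (λ i → any? (dominant? G c i)) not-dom
  ... | i , none with merge-class c onto proper i (λ x d → none (x , d))
  ...   | c′ , onto′ , proper′ = b-colouring-from k c′ onto′ proper′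

  -- Every simple graph has a b-colouring, starting from the colouring by the vertices themselves.
  b-colouring-exists : ∃ (HasBColoring G)
  b-colouring-exists = b-colouring-from (n G) (λ x → x) (λ i → i , refl) λ _ _ → adjacent⇒distinct G simple

-- Dominating colourings are complete, so their number of colours is bounded by ψ.
dominating≤ψ : ∀ H {k j} → IsPsi H k → HasDominatingColoring H j → j ≤ k
dominating≤ψ H (_ , ψ-max) (c , onto , dom) = ψ-max _ (c , onto , dominating⇒complete H c dom)

-- (1) ⇒ (2) on one graph: a b-colouring is proper, so it has at least ω colours, and
-- dominating, so at most ψ; when ω = ψ its number of colours is this common value.
ω=ψ⇒b=ψ : ∀ H → IsSimple H → SameValue IsOmega IsPsi H → SameValue IsB IsPsi H
ω=ψ⇒b=ψ H simple (k , (clique , _) , ψ) = k , (subst (HasBColoring H) m≡k b-colouring , b-max) , ψ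
  where
  m : ℕ
  m = proj₁ (b-colouring-exists H simple)
  b-colouring : HasBColoring H m
  b-colouring = proj₂ (b-colouring-exists H simple)
  b-max : ∀ j → HasBColoring H j → j ≤ k
  b-max j (c , onto , _ , dom) = dominating≤ψ H ψ (c , onto , dom)
  m≡k : m ≡ k
  m≡k with b-colouring
  ... | c , _ , proper , _ = ≤-antisym (b-max m b-colouring) (clique≤colours H c proper clique)

b=ψ⇒B=ψ : ∀ H → SameValue IsB IsPsi H → SameValue IsPseudoB IsPsi H
b=ψ⇒B=ψ H (k , ((c , onto , _ , dom) , _) , ψ) = k , ((c , onto , dom) , λ _ → dominating≤ψ H ψ) , ψ

-- (3) ⇒ (4): if ψ(F) ≥ 3 but F has no dominating colouring with ≥ 3 colours, then every induced
-- copy of F in G is an induced subgraph with B < ψ.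
copy-has-B<ψ : ∀ F G → HasCompleteColoring F 3 → (∀ {k} → 3 ≤ k → ¬ HasDominatingColoring F k) →
               HasInduced F G → ¬ ForAllInduced (SameValue IsPseudoB IsPsi) G
copy-has-B<ψ F G (c₃ , onto₃ , complete₃) no-dominating (f , f-inj , same) B=ψ
  with B=ψ (n F) f f-inj
... | k , ((c , onto , dom) , _) , (_ , ψ-max) =
  no-dominating (ψ-max 3 (c₃ , onto₃ , complete-mono to-copy c₃ complete₃))
                (c , onto , dominating-mono to-F c dom)
  where
  to-copy : ∀ x y → adj F x y ≡ true → adj G (f x) (f y) ≡ true
  to-copy x y = trans (sym (same x y))
  to-F : ∀ x y → adj G (f x) (f y) ≡ true → adj F x y ≡ true
  to-F x y = trans (same x y)

B=ψ⇒forbidden-free : ∀ G → ForAllInduced (SameValue IsPseudoB IsPsi) G → ¬ Forbidden G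
B=ψ⇒forbidden-free G B=ψ (inj₁ copy) =
  copy-has-B<ψ C4 G C4-colouring C4-no-dominating copy B=ψ
B=ψ⇒forbidden-free G B=ψ (inj₂ (inj₁ copy)) =
  copy-has-B<ψ P4 G P4-colouring (few-high-degree⇒no-dominating P4 (from-yes (#degree≥ P4 2 ≤? 2))) copy B=ψ
B=ψ⇒forbidden-free G B=ψ (inj₂ (inj₂ (inj₁ copy))) =
  copy-has-B<ψ P3∪K2 G P3∪K2-colouring (few-high-degree⇒no-dominating P3∪K2 (from-yes (#degree≥ P3∪K2 2 ≤? 2))) copy B=ψ
B=ψ⇒forbidden-free G B=ψ (inj₂ (inj₂ (inj₂ copy))) =
  copy-has-B<ψ 3K2 G 3K2-colouring (few-high-degree⇒no-dominating 3K2 (from-yes (#degree≥ 3K2 2 ≤? 2))) copy B=ψ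

closed : (G : Graph) → Fin (n G) → Fin (n G) → Bool
closed G v x = does (v ≟ x) ∨ adj G v x

closedDegree : (G : Graph) → Fin (n G) → ℕ
closedDegree G v = count (closed G v)

closed-intro : ∀ G {v x} → (v ≢ x → Edge G v x) → closed G v x ≡ true
closed-intro G {v} {x} edge with v ≟ x
... | yes _   = refl
... | no  v≢x = edge v≢x

closed-elim : ∀ G {v x} → closed G v x ≡ true → v ≡ x ⊎ Edge G v x
closed-elim G {v} {x} vx with v ≟ x
... | yes v≡x = inj₁ v≡x
... | no  _   = inj₂ vx

closed-neighbour : ∀ G {v x} → closed G v x ≡ true → v ≢ x → Edge G v x
closed-neighbour G x∈ v≢x with closed-elim G x∈
... | inj₁ v≡x = ⊥-elim (v≢x v≡x)
... | inj₂ vx  = vx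

closed-outside : ∀ G {v x} → closed G v x ≡ false → v ≢ x × adj G v x ≡ false
closed-outside G {v} {x} vx with v ≟ x
... | yes _   with () ← vx
... | no  v≢x = v≢x , vx

maximiser : ∀ {m} (h : Fin (suc m) → ℕ) → ∃[ v ] (∀ x → h x ≤ h v)
maximiser {zero}  h = zero , λ { zero → ≤-refl }
maximiser {suc m} h with maximiser (h ∘ suc)
... | v , v-max with h zero ≤? h (suc v)
...   | yes h0≤ = suc v , λ { zero → h0≤ ; (suc x) → v-max x }
...   | no  h0≰ = zero , λ { zero → ≤-refl ; (suc x) → ≤-trans (v-max x) (<⇒≤ (≰⇒> h0≰)) }

-- ψ ≤ ω for forbidden-free graphs

-- ψ ≤ ω, witnessed: a clique of size k and no complete colouring with more than k colours.
CliqueBound : Graph → Set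
CliqueBound G = ∃[ k ] (HasClique G k × (∀ j → HasCompleteColoring G j → j ≤ k))

-- Colourings with at most one colour are bounded by any positive number.
bound-from-two : ∀ {G K} → 1 ≤ K → (∀ j → HasCompleteColoring G (2 + j) → 2 + j ≤ K) →
                 ∀ j → HasCompleteColoring G j → j ≤ K
bound-from-two _   _     zero          _   = z≤n
bound-from-two 1≤K _     (suc zero)    _   = 1≤K
bound-from-two _   bound (suc (suc j)) col = bound j col

module Deletion {m} (a : Fin (suc m) → Fin (suc m) → Bool) (u : Fin (suc m)) where
  G G-u : Graph
  G   = mkGraph (suc m) a
  G-u = induced G (punchIn u)

  preimage : ∀ x → u ≢ x → ∃[ x′ ] punchIn u x′ ≡ x
  preimage x u≢x = punchOut u≢x , punchIn-punchOut u≢x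

  edge-preimage : ∀ {x y} → u ≢ x → u ≢ y → a x y ≡ true →
                  ∃[ x′ ] ∃[ y′ ] (Edge G-u x′ y′ × punchIn u x′ ≡ x × punchIn u y′ ≡ y)
  edge-preimage {x} {y} u≢x u≢y xy with preimage x u≢x | preimage y u≢y
  ... | x′ , refl | y′ , refl = x′ , y′ , xy , refl , refl

  lift-clique : ∀ {k} → HasClique G-u k → HasClique G k
  lift-clique (g , g-inj , edges) = punchIn u ∘ g , g-inj ∘ punchIn-injective u _ _ , edges

  -- a complete colouring loses at most the colour of u: merge it into colour 0
  restrict-complete : ∀ {j} → HasCompleteColoring G (2 + j) → HasCompleteColoring G-u (1 + j)
  restrict-complete {j} (c , onto , complete) = c′ , onto′ , complete′
    where
    merge : Fin (2 + j) → Fin (1 + j)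
    merge l with c u ≟ l
    ... | yes _     = zero
    ... | no  cu≢l  = punchOut cu≢l
    merge-other : ∀ t → merge (punchIn (c u) t) ≡ t
    merge-other t with c u ≟ punchIn (c u) t
    ... | yes cu≡ = ⊥-elim (punchInᵢ≢i (c u) t (sym cu≡))
    ... | no  cu≢ = trans (punchOut-cong (c u) refl) (punchOut-punchIn (c u))
    c′ : Fin m → Fin (1 + j)
    c′ = merge ∘ c ∘ punchIn u
    not-u : ∀ {x t} → c x ≡ punchIn (c u) t → u ≢ x
    not-u {t = t} cx u≡x = punchInᵢ≢i (c u) t (sym (trans (cong c u≡x) cx))
    recoloured : ∀ {x′ x t} → punchIn u x′ ≡ x → c x ≡ punchIn (c u) t → c′ x′ ≡ t
    recoloured refl cx = trans (cong merge cx) (merge-other _)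
    onto′ : Surj c′
    onto′ t with onto (punchIn (c u) t)
    ... | x , cx with preimage x (not-u cx)
    ...   | x′ , x′↦x = x′ , recoloured x′↦x cx
    complete′ : Complete G-u c′
    complete′ t t′ t≢t′ with complete (punchIn (c u) t) (punchIn (c u) t′) (t≢t′ ∘ punchIn-injective (c u) t t′)
    ... | x , y , xy , cx , cy with edge-preimage (not-u cx) (not-u cy) xy
    ...   | x′ , y′ , x′y′ , x′↦x , y′↦y = x′ , y′ , x′y′ , recoloured x′↦x cx , recoloured y′↦y cy

  -- when u is isolated no colour is lost: every class of a complete colouring with ≥ 2
  -- colours contains an endpoint of an edge, which is not u
  restrict-complete-isolated : ∀ {j} → IsSimple G → (∀ y → a u y ≡ false) →
                               HasCompleteColoring G (2 + j) → HasCompleteColoring G-u (2 + j)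
  restrict-complete-isolated {j} (symmetric , _) isolated (c , onto , complete) = c ∘ punchIn u , onto′ , complete′
    where
    not-u : ∀ {x y} → a x y ≡ true → u ≢ x × u ≢ y
    not-u {x} {y} xy = (λ { refl → not-¬ (isolated y) xy }) , λ { refl → not-¬ (isolated x) (trans (symmetric u x) xy) }
    another : (i : Fin (2 + j)) → ∃[ i′ ] i ≢ i′
    another zero    = suc zero , λ ()
    another (suc _) = zero , λ ()
    onto′ : Surj (c ∘ punchIn u)
    onto′ i with complete i (proj₁ (another i)) (proj₂ (another i))
    ... | x , y , xy , cx , _ with preimage x (proj₁ (not-u xy))
    ...   | x′ , refl = x′ , cx
    complete′ : Complete G-u (c ∘ punchIn u)
    complete′ t t′ t≢t′ with complete t t′ t≢t′
    ... | x , y , xy , cx , cy with edge-preimage (proj₁ (not-u xy)) (proj₂ (not-u xy)) xy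
    ...   | x′ , y′ , x′y′ , refl , refl = x′ , y′ , x′y′ , cx , cy

  -- An isolated vertex adds no colours; {u} is a clique in case G − u has none.
  isolated-step : IsSimple G → (∀ y → a u y ≡ false) → CliqueBound G-u → CliqueBound G
  isolated-step simple isolated (zero , _ , bound) =
    1 , ((λ _ → u) , (λ { {zero} {zero} _ → refl }) , λ { zero zero 0≢0 → ⊥-elim (0≢0 refl) }) ,
    bound-from-two ≤-refl λ j col → ⊥-elim (<⇒≱ (s≤s z≤n) (bound _ (restrict-complete-isolated simple isolated col)))
  isolated-step simple isolated (suc k , clique , bound) =
    suc k , lift-clique clique ,
    bound-from-two (s≤s z≤n) λ j col → bound _ (restrict-complete-isolated simple isolated col)

  -- A vertex adjacent to all others extends every clique of G − u and adds at most one colour.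
  universal-step : IsSimple G → (∀ x → u ≢ x → a u x ≡ true) → CliqueBound G-u → CliqueBound G
  universal-step (symmetric , _) universal (k , (g , g-inj , edges) , bound) =
    suc k , (g′ , g′-inj , edges′) , bound-from-two (s≤s z≤n) λ j col → s≤s (bound _ (restrict-complete col))
    where
    g′ : Fin (suc k) → Fin (suc m)
    g′ zero    = u
    g′ (suc i) = punchIn u (g i)
    g′-inj : ∀ {i j} → g′ i ≡ g′ j → i ≡ j
    g′-inj {zero}  {zero}  _ = refl
    g′-inj {zero}  {suc j} e = ⊥-elim (punchInᵢ≢i u (g j) (sym e))
    g′-inj {suc i} {zero}  e = ⊥-elim (punchInᵢ≢i u (g i) e)
    g′-inj {suc i} {suc j} e = cong suc (g-inj (punchIn-injective u _ _ e))
    edges′ : ∀ i j → i ≢ j → a (g′ i) (g′ j) ≡ true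
    edges′ zero    zero    0≢0 = ⊥-elim (0≢0 refl)
    edges′ zero    (suc j) _   = universal _ (punchInᵢ≢i u (g j) ∘ sym)
    edges′ (suc i) zero    _   = trans (symmetric _ u) (universal _ (punchInᵢ≢i u (g i) ∘ sym))
    edges′ (suc i) (suc j) i≢j = edges i j (i≢j ∘ cong suc)

-- Configurations that cannot occur in a simple forbidden-free graph. Each lists the
-- vertices of a would-be induced copy and the adjacencies of its pairs in lexicographic order.
module ForbiddenFree {m} (a : Fin m → Fin m → Bool) (simple : IsSimple (mkGraph m a))
                     (free : ¬ Forbidden (mkGraph m a)) where

  G : Graph
  G = mkGraph m a

  flip : ∀ {x y b} → a x y ≡ b → a y x ≡ b
  flip {x} {y} xy = trans (proj₁ simple y x) xy

  no-C4 : (vs : Vec (Fin m) 4) → All (Agrees C4 G (lookup vs)) (pairs 4) → All (Apart (lookup vs)) (twinPairs C4) → ⊥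
  no-C4 vs agrees apart = free (inj₁ (embed simple C4-simple vs agrees apart))

  no-P4 : (vs : Vec (Fin m) 4) → All (Agrees P4 G (lookup vs)) (pairs 4) → All (Apart (lookup vs)) (twinPairs P4) → ⊥
  no-P4 vs agrees apart = free (inj₂ (inj₁ (embed simple P4-simple vs agrees apart)))

  no-P3∪K2 : (vs : Vec (Fin m) 5) → All (Agrees P3∪K2 G (lookup vs)) (pairs 5) →
             All (Apart (lookup vs)) (twinPairs P3∪K2) → ⊥
  no-P3∪K2 vs agrees apart = free (inj₂ (inj₂ (inj₁ (embed simple P3∪K2-simple vs agrees apart))))

  no-3K2 : (vs : Vec (Fin m) 6) → All (Agrees 3K2 G (lookup vs)) (pairs 6) → All (Apart (lookup vs)) (twinPairs 3K2) → ⊥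
  no-3K2 vs agrees apart = free (inj₂ (inj₂ (inj₂ (embed simple 3K2-simple vs agrees apart))))

  -- a path y′ v y z with y′ ≁ y and v ≁ z closes to a C4 or is an induced P4
  no-long-path : ∀ y′ v y z → a y′ v ≡ true → a y′ y ≡ false → a v y ≡ true → a v z ≡ false →
                 a y z ≡ true → y′ ≢ y → v ≢ z → ⊥
  no-long-path y′ v y z y′v y′≁y vy v≁z yz y′≢y v≢z with a y′ z Bool.≟ true
  ... | yes y′z  = no-C4 (y′ ∷ v ∷ y ∷ z ∷ []) (y′v ∷ y′≁y ∷ y′z ∷ vy ∷ v≁z ∷ yz ∷ []) (y′≢y ∷ v≢z ∷ [])
  ... | no  y′≁z = no-P4 (y′ ∷ v ∷ y ∷ z ∷ []) (y′v ∷ y′≁y ∷ ¬-not y′≁z ∷ vy ∷ v≁z ∷ yz ∷ []) []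

-- Then N[v] is a clique with no edge leaving it,
-- a non-neighbour w of v is adjacent to everything outside N[v], and every complete colouring
-- lives on N[v] or on N[w]; so ψ = ω = |N[v]|.
module MaximumDegree {m} (a : Fin m → Fin m → Bool) (simple : IsSimple (mkGraph m a))
  (free : ¬ Forbidden (mkGraph m a)) (neighbour : ∀ u → ∃[ y ] a u y ≡ true)
  (v : Fin m) (v-max : ∀ x → closedDegree (mkGraph m a) x ≤ closedDegree (mkGraph m a) v)
  (w : Fin m) (w∉N[v] : closed (mkGraph m a) v w ≡ false) where

  open ForbiddenFree a simple free

  -- No edge y z leaves N[v]: as |N[y]| ≤ |N[v]| while z ∈ N[y] ∖ N[v], some y′ ∈ N[v] lies
  -- outside N[y], and y′ v y z is a forbidden path.
  in↛out : ∀ {y z} → closed G v y ≡ true → closed G v z ≡ false → a y z ≡ false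
  in↛out {y} {z} y∈ z∉ = ¬-not {y = true} leaving
    where
    leaving : a y z ≢ true
    leaving yz with closed-elim G y∈
    ... | inj₁ refl with () ← trans (sym (closed-intro G (const yz))) z∉
    ... | inj₂ vy with any? (λ t → closed G v t Bool.≟ true ×-dec closed G y t Bool.≟ false)
    ...   | no none = <⇒≱ (count-< N[v]⊆N[y] z z∉ (closed-intro G (const yz))) (v-max y)
      where
      N[v]⊆N[y] : ∀ t → closed G v t ≡ true → closed G y t ≡ true
      N[v]⊆N[y] t t∈ = ¬-not {y = false} (λ t∉ → none (t , t∈ , t∉))
    ...   | yes (y′ , y′∈ , y′∉N[y]) with closed-outside G y′∉N[y] | closed-outside G z∉
    ...     | y≢y′ , y≁y′ | v≢z , v≁z =
      no-long-path y′ v y z (flip (closed-neighbour G y′∈ v≢y′)) (flip y≁y′) vy v≁z yz (y≢y′ ∘ sym) v≢z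
      where
      v≢y′ : v ≢ y′
      v≢y′ refl with () ← trans (sym (flip vy)) y≁y′

  stays-outside : ∀ {x x′} → closed G v x ≡ false → a x x′ ≡ true → closed G v x′ ≡ false
  stays-outside x∉ xx′ = ¬-not {y = true} λ x′∈ → not-¬ (in↛out x′∈ x∉) (flip xx′)

  out↛in : ∀ {x y} → closed G v x ≡ false → closed G v y ≡ true → a x y ≡ false
  out↛in x∉ y∈ = flip (in↛out y∈ x∉)

  v∈N[v] : closed G v v ≡ true
  v∈N[v] = closed-intro G (λ v≢v → ⊥-elim (v≢v refl))

  w′ : Fin m
  w′ = proj₁ (neighbour w)

  ww′ : a w w′ ≡ true
  ww′ = proj₂ (neighbour w)

  w′∉N[v] : closed G v w′ ≡ false
  w′∉N[v] = stays-outside w∉N[v] ww′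

  -- N[v] is a clique: two non-adjacent neighbours of v would form, with the edge w w′ outside
  -- N[v], an induced P3 ∪ K2.
  N[v]-clique : ∀ y y′ → closed G v y ≡ true → closed G v y′ ≡ true → y ≢ y′ → a y y′ ≡ true
  N[v]-clique y y′ y∈ y′∈ y≢y′ with closed-elim G y∈ | closed-elim G y′∈
  ... | inj₁ refl | _         = closed-neighbour G y′∈ y≢y′
  ... | inj₂ _    | inj₁ refl = flip (closed-neighbour G y∈ (y≢y′ ∘ sym))
  ... | inj₂ vy   | inj₂ vy′  = ¬-not {y = false} λ y≁y′ →
    no-P3∪K2 (y ∷ v ∷ y′ ∷ w ∷ w′ ∷ [])
      (flip vy ∷ y≁y′ ∷ in↛out y∈ w∉N[v] ∷ in↛out y∈ w′∉N[v] ∷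
       vy′ ∷ in↛out v∈N[v] w∉N[v] ∷ in↛out v∈N[v] w′∉N[v] ∷
       in↛out y′∈ w∉N[v] ∷ in↛out y′∈ w′∉N[v] ∷ ww′ ∷ [])
      (y≢y′ ∷ [])

  -- w is adjacent to every other vertex z outside N[v]. Otherwise, with neighbours s₁ of w,
  -- s₂ of z (both outside N[v]) and v′ of v, the edges w s₁, z s₂ and v v′ form an induced
  -- P3 ∪ K2, P4 or 3K2 according to the adjacencies among w, s₁, z, s₂.
  w-sees-outside : ∀ z → closed G v z ≡ false → w ≢ z → a w z ≡ true
  w-sees-outside z z∉ w≢z = ¬-not {y = false} non-adjacent
    where
    s₁ s₂ v′ : Fin m
    s₁ = proj₁ (neighbour w)
    s₂ = proj₁ (neighbour z)
    v′ = proj₁ (neighbour v)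
    ws₁ : a w s₁ ≡ true
    ws₁ = proj₂ (neighbour w)
    zs₂ : a z s₂ ≡ true
    zs₂ = proj₂ (neighbour z)
    vv′ : a v v′ ≡ true
    vv′ = proj₂ (neighbour v)
    s₁∉ : closed G v s₁ ≡ false
    s₁∉ = stays-outside w∉N[v] ws₁
    s₂∉ : closed G v s₂ ≡ false
    s₂∉ = stays-outside z∉ zs₂
    v′∈ : closed G v v′ ≡ true
    v′∈ = closed-intro G (const vv′)
    non-adjacent : a w z ≢ false
    non-adjacent w≁z with a s₁ z Bool.≟ true | a s₂ w Bool.≟ true | a s₁ s₂ Bool.≟ true
    ... | yes s₁z  | _        | _ =
      no-P3∪K2 (w ∷ s₁ ∷ z ∷ v ∷ v′ ∷ [])
        (ws₁ ∷ w≁z ∷ out↛in w∉N[v] v∈N[v] ∷ out↛in w∉N[v] v′∈ ∷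
         s₁z ∷ out↛in s₁∉ v∈N[v] ∷ out↛in s₁∉ v′∈ ∷
         out↛in z∉ v∈N[v] ∷ out↛in z∉ v′∈ ∷ vv′ ∷ [])
        (w≢z ∷ [])
    ... | no  _    | yes s₂w  | _ =
      no-P3∪K2 (z ∷ s₂ ∷ w ∷ v ∷ v′ ∷ [])
        (zs₂ ∷ flip w≁z ∷ out↛in z∉ v∈N[v] ∷ out↛in z∉ v′∈ ∷
         s₂w ∷ out↛in s₂∉ v∈N[v] ∷ out↛in s₂∉ v′∈ ∷
         out↛in w∉N[v] v∈N[v] ∷ out↛in w∉N[v] v′∈ ∷ vv′ ∷ [])
        (w≢z ∘ sym ∷ [])
    ... | no  s₁≁z | no  s₂≁w | yes s₁s₂ =
      no-P4 (w ∷ s₁ ∷ s₂ ∷ z ∷ [])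
        (ws₁ ∷ flip (¬-not s₂≁w) ∷ w≁z ∷ s₁s₂ ∷ ¬-not s₁≁z ∷ flip zs₂ ∷ []) []
    ... | no  s₁≁z | no  s₂≁w | no  s₁≁s₂ =
      no-3K2 (w ∷ s₁ ∷ z ∷ s₂ ∷ v ∷ v′ ∷ [])
        (ws₁ ∷ w≁z ∷ flip (¬-not s₂≁w) ∷ out↛in w∉N[v] v∈N[v] ∷ out↛in w∉N[v] v′∈ ∷
         ¬-not s₁≁z ∷ ¬-not s₁≁s₂ ∷ out↛in s₁∉ v∈N[v] ∷ out↛in s₁∉ v′∈ ∷
         zs₂ ∷ out↛in z∉ v∈N[v] ∷ out↛in z∉ v′∈ ∷
         out↛in s₂∉ v∈N[v] ∷ out↛in s₂∉ v′∈ ∷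
         vv′ ∷ [])
        []

  -- No complete colouring has more than |N[v]| colours: if some colour p misses N[v], its class
  -- lies outside N[v] and so do all neighbours of that class; hence every colour occurs on
  -- N[w], and |N[w]| ≤ |N[v]|.
  colour-bound : ∀ j → HasCompleteColoring G j → j ≤ closedDegree G v
  colour-bound j (c , onto , complete) with all? (λ i → any? λ x → closed G v x Bool.≟ true ×-dec c x ≟ i)
  ... | yes on-N[v] = colours≤count (closed G v) c on-N[v]
  ... | no  not-all with ¬∀⟶∃¬ _ _ (λ i → any? λ x → closed G v x Bool.≟ true ×-dec c x ≟ i) not-all
  ...   | p , p-misses = ≤-trans (colours≤count (closed G w) c on-N[w]) (v-max w)
    where
    class-p-outside : ∀ {x} → c x ≡ p → closed G v x ≡ false
    class-p-outside {x} cx = ¬-not (λ x∈ → p-misses (x , x∈ , cx))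
    outside⇒N[w] : ∀ {z} → closed G v z ≡ false → closed G w z ≡ true
    outside⇒N[w] z∉ = closed-intro G (w-sees-outside _ z∉)
    on-N[w] : ∀ i → ∃[ x ] (closed G w x ≡ true × c x ≡ i)
    on-N[w] i with i ≟ p
    ... | yes refl = let x , cx = onto i in x , outside⇒N[w] (class-p-outside cx) , cx
    ... | no  i≢p  = let x , y , xy , cx , cy = complete p i (i≢p ∘ sym) in
                     y , outside⇒N[w] (stays-outside (class-p-outside cx) xy) , cy

  clique-bound : CliqueBound G
  clique-bound = closedDegree G v , (element , injective , edges) , colour-bound
    where
    open Enumeration (enumerate (closed G v))
    edges : ∀ i j → i ≢ j → a (element i) (element j) ≡ true
    edges i j i≢j = N[v]-clique _ _ (sound i) (sound j) (i≢j ∘ injective)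

-- One inductive step: the bound for G follows from the bounds for all G − u. Delete an isolated
-- or a universal vertex if there is one; otherwise a vertex of maximum closed degree settles G.
clique-bound-step : ∀ {m} (a : Fin (suc m) → Fin (suc m) → Bool) →
                    IsSimple (mkGraph (suc m) a) → ¬ Forbidden (mkGraph (suc m) a) →
                    (∀ u → CliqueBound (induced (mkGraph (suc m) a) (punchIn u))) → CliqueBound (mkGraph (suc m) a)
clique-bound-step a simple free delete with any? (λ u → all? λ y → a u y Bool.≟ false)
... | yes (u , isolated) = Deletion.isolated-step a u simple isolated (delete u)
... | no  no-isolated with maximiser (closedDegree (mkGraph _ a))
...   | v , v-max with all? (λ x → closed (mkGraph _ a) v x Bool.≟ true)
...     | yes universal =
  Deletion.universal-step a v simple (λ x → closed-neighbour (mkGraph _ a) (universal x)) (delete v)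
...     | no  not-universal with ¬∀⟶∃¬ _ _ (λ x → closed (mkGraph _ a) v x Bool.≟ true) not-universal
...       | w , w∉N[v] = MaximumDegree.clique-bound a simple free neighbour v v-max w (¬-not w∉N[v])
  where
  neighbour : ∀ u → ∃[ y ] a u y ≡ true
  neighbour u with ¬∀⟶∃¬ _ _ (λ y → a u y Bool.≟ false) (λ none → no-isolated (u , none))
  ... | y , not-false = y , ¬-not not-false

ψ≤ω : ∀ m (a : Fin m → Fin m → Bool) → IsSimple (mkGraph m a) → ¬ Forbidden (mkGraph m a) →
      CliqueBound (mkGraph m a)
ψ≤ω zero    a _      _    = 0 , ((λ ()) , (λ { {()} }) , λ ()) , λ j (c , onto , _) → surjective⇒≤ c onto
ψ≤ω (suc m) a simple free = clique-bound-step a simple free λ u →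
  ψ≤ω m _ (simple-induced G (punchIn u) simple) (forbidden-free-induced G (punchIn u) (punchIn-injective u _ _) free)
  where
  G : Graph
  G = mkGraph (suc m) a

-- With a clique of size k and no complete colouring beyond k colours there is a complete
-- k-colouring; for k = 0 the graph has no vertex, as one vertex already gives a 1-colouring.
complete-of-size : ∀ H {k} → HasClique H k → (∀ j → HasCompleteColoring H j → j ≤ k) → HasCompleteColoring H k
complete-of-size H {suc k} clique _     = clique⇒complete H clique
complete-of-size H {zero}  _      bound = (λ x → ⊥-elim (no-vertex x)) , (λ ()) , λ ()
  where
  no-vertex : Fin (n H) → ⊥
  no-vertex x = <⇒≱ (s≤s z≤n) (bound 1 ((λ _ → zero) , (λ { zero → x , refl }) , λ { zero zero 0≢0 → ⊥-elim (0≢0 refl) }))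

-- A clique bound gives ω = ψ: cliques of size j ≥ 1 yield complete j-colourings.
clique-bound⇒ω=ψ : ∀ H → CliqueBound H → SameValue IsOmega IsPsi H
clique-bound⇒ω=ψ H (k , clique , bound) = k , (clique , ω-max) , complete-of-size H clique bound , bound
  where
  ω-max : ∀ j → HasClique H j → j ≤ k
  ω-max zero    _        = z≤n
  ω-max (suc j) clique-j = bound _ (clique⇒complete H clique-j)

corollary5 : (G : Graph) → IsSimple G →
    (ForAllInduced (SameValue IsOmega IsPsi) G ⇔ ForAllInduced (SameValue IsB IsPsi) G)
    × (ForAllInduced (SameValue IsB IsPsi) G ⇔ ForAllInduced (SameValue IsPseudoB IsPsi) G)
    × (ForAllInduced (SameValue IsPseudoB IsPsi) G ⇔ (¬ Forbidden G))
corollary5 G simple =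
  mk⇔ ω⇒b (free⇒ω ∘ B⇒free ∘ b⇒B) , mk⇔ b⇒B (ω⇒b ∘ free⇒ω ∘ B⇒free) , mk⇔ B⇒free (b⇒B ∘ ω⇒b ∘ free⇒ω)
  where
  ω⇒b : ForAllInduced (SameValue IsOmega IsPsi) G → ForAllInduced (SameValue IsB IsPsi) G
  ω⇒b ω=ψ m f f-inj = ω=ψ⇒b=ψ (induced G f) (simple-induced G f simple) (ω=ψ m f f-inj)
  b⇒B : ForAllInduced (SameValue IsB IsPsi) G → ForAllInduced (SameValue IsPseudoB IsPsi) G
  b⇒B b=ψ m f f-inj = b=ψ⇒B=ψ (induced G f) (b=ψ m f f-inj)
  B⇒free : ForAllInduced (SameValue IsPseudoB IsPsi) G → ¬ Forbidden G
  B⇒free = B=ψ⇒forbidden-free G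
  free⇒ω : ¬ Forbidden G → ForAllInduced (SameValue IsOmega IsPsi) G
  free⇒ω free m f f-inj = clique-bound⇒ω=ψ (induced G f)
    (ψ≤ω m _ (simple-induced G f simple) (forbidden-free-induced G f f-inj free))
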